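{- Let $r\ge 1$ and let $\sigma_1,\dots,\sigma_m$ and $\rho_1,\dots,\rho_m$ be sequences, each of length at most $r$, such that for all $i,j\in\{1,\dots,m\}$, $\sigma_i$ is $r$-compatible to $\rho_i$, and $\sigma_i$ is not $r$-compatible to $\rho_j$ whenever $i<j$. Then $m\le (r\cdot e)^r$.
   Context: $e$ is Euler's number. For sequences $\sigma=(a_1,\dots,a_n)$, $\rho=(b_1,\dots,b_{n'})$, $\sigma$ is $r$-compatible to $\rho$ if for all $j\in\{1,\dots,r\}$: $\{a_{\max(1,n-j+1)},\dots,a_n\}\cap\{b_1,\dots,b_{\min(r-j+1,n')}\}=\emptyset$. -}

module Defs where

open import Data.Nat using (ℕ; zero; suc; _+_; _*_; _∸_; _^_; _≤_; _/_; _!)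
open import Data.Nat.Properties using (_!≢0)
open import Data.Nat.ListAction using (sum)
open import Data.Fin using (Fin; toℕ)
open import Data.List using (List; length; take; drop; upTo; map)
open import Data.List.Membership.Propositional using (_∈_)
open import Data.Empty using (⊥)

Disjoint : {A : Set} → List A → List A → Set
Disjoint xs ys = ∀ x → x ∈ xs → x ∈ ys → ⊥

-- σ = (a_1..a_n) is r-compatible to ρ = (b_1..b_n') iff for all j ∈ {1..r}:
--   {a_max(1,n-j+1), .., a_n} ∩ {b_1, .., b_min(r-j+1,n')} = ∅.
-- The suffix {a_max(1,n-j+1)..a_n} is  drop (n ∸ j) σ  (the last min(j,n) entries),
-- the prefix {b_1..b_min(r-j+1,n')} is  take (r ∸ j + 1) ρ  (take truncates at n').
Compatible : {A : Set} → ℕ → List A → List A → Set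
Compatible r σ ρ =
  (k : Fin r) → let j = suc (toℕ k) in
    Disjoint (drop (length σ ∸ j) σ) (take (r ∸ j + 1) ρ)

-- Rational upper approximations of Euler's number e, for N ≥ 1:
--   e < eUpper N = Σ_{k=0}^{N} 1/k! + 1/(N·N!)  and  eUpper N ↘ e as N → ∞.
-- We write eUpper N = eNum N / eDen N with natural numbers
--   eDen N = N · N!,   eNum N = N · (Σ_{k=0}^{N} N!/k!) + 1
-- (N!/k! is an exact natural-number division for k ≤ N).
eDen : ℕ → ℕ
eDen N = N * (N !)

eNum : ℕ → ℕ
eNum N = N * sum (map (λ k → ((N !) / (k !)) {{k !≢0}}) (upTo (suc N))) + 1

-- "m ≤ (r·e)^r" for a natural number m, expressed without real numbers:
-- since eUpper N decreases to e, m ≤ (r·e)^r holds iff for every N ≥ 1,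
--   m ≤ (r · eNum N / eDen N)^r,  i.e.  m · (eDen N)^r ≤ (r · eNum N)^r.
LeREPowR : ℕ → ℕ → Set
LeREPowR m r = (N : ℕ) → 1 ≤ N → m * (eDen N ^ r) ≤ (r * eNum N) ^ r

{-# OPTIONS --safe #-}
module Submission where

-- Code σ by the pairs (x , q) with x the entry of σ sitting q places before its end, and ρ by
-- the pairs (y , q) with y sitting i places after the start of ρ and i + q < r.  Then σ is
-- r-compatible to ρ exactly when the codes are disjoint, so the codes form a skew Bollobás
-- system of m pairs of sets of sizes a ≤ r and b ≤ r (r + 1) / 2, and m ≤ C(a + b , a).
--
-- For a set A of integers let P_A = ∏_{x ∈ A} (z - x),
-- of degree a, and let X_A be the vector of all monomials of degree b in the a + 1 coefficients
-- of P_A; for a set B let Y_B be the coefficient vector of the product over y ∈ B of the linear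
-- forms "evaluate at y".  Then X_A ∙ Y_B = ∏_{y ∈ B} P_A(y), which vanishes iff A meets B, so the
-- matrix (X_{A i} ∙ Y_{B j}) is triangular with nonzero diagonal and m is at most the dimension
-- C(a + b , a).  Finally C(r + r (r + 1) / 2 , r) ≤ (r (r + 3) / 2)^r / r! ≤ (2.7 r)^r ≤ (e r)^r.

module IntegerVectors where

  open import Data.Integer using (ℤ; 0ℤ; _+_; _*_)
  import Data.Integer.Properties as ℤ
  open import Data.Integer.Solver using (module +-*-Solver)
  open import Data.Vec as Vec using (Vec; []; _∷_; _++_)
  open import Relation.Binary.PropositionalEquality
  open +-*-Solver

  infixl 7 _·ᵥ_
  infixl 6 _+ᵥ_
  infix  8 _∙_

  _·ᵥ_ : ∀ {n} → ℤ → Vec ℤ n → Vec ℤ n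
  k ·ᵥ v = Vec.map (k *_) v

  _+ᵥ_ : ∀ {n} → Vec ℤ n → Vec ℤ n → Vec ℤ n
  _+ᵥ_ = Vec.zipWith _+_

  _∙_ : ∀ {n} → Vec ℤ n → Vec ℤ n → ℤ
  []       ∙ []       = 0ℤ
  (x ∷ xs) ∙ (y ∷ ys) = x * y + xs ∙ ys

  ∙-comm : ∀ {n} (u v : Vec ℤ n) → u ∙ v ≡ v ∙ u
  ∙-comm []       []       = refl
  ∙-comm (x ∷ xs) (y ∷ ys) = cong₂ _+_ (ℤ.*-comm x y) (∙-comm xs ys)

  ∙-·ˡ : ∀ {n} k (u v : Vec ℤ n) → (k ·ᵥ u) ∙ v ≡ k * (u ∙ v)
  ∙-·ˡ k []       []       = sym (ℤ.*-zeroʳ k)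
  ∙-·ˡ k (x ∷ xs) (y ∷ ys) rewrite ∙-·ˡ k xs ys =
    solve 4 (λ k x y d → k :* x :* y :+ k :* d := k :* (x :* y :+ d)) refl k x y (xs ∙ ys)

  ∙-·ʳ : ∀ {n} k (u v : Vec ℤ n) → u ∙ (k ·ᵥ v) ≡ k * (u ∙ v)
  ∙-·ʳ k u v = trans (∙-comm u (k ·ᵥ v)) (trans (∙-·ˡ k v u) (cong (k *_) (∙-comm v u)))

  ∙-+ˡ : ∀ {n} (u v w : Vec ℤ n) → (u +ᵥ v) ∙ w ≡ u ∙ w + v ∙ w
  ∙-+ˡ []       []       []       = refl
  ∙-+ˡ (x ∷ xs) (y ∷ ys) (z ∷ zs) rewrite ∙-+ˡ xs ys zs =
    solve 5 (λ x y z a b → (x :+ y) :* z :+ (a :+ b) := (x :* z :+ a) :+ (y :* z :+ b))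
      refl x y z (xs ∙ zs) (ys ∙ zs)

  ∙-+ʳ : ∀ {n} (u v w : Vec ℤ n) → u ∙ (v +ᵥ w) ≡ u ∙ v + u ∙ w
  ∙-+ʳ u v w = trans (∙-comm u (v +ᵥ w)) (trans (∙-+ˡ v w u) (cong₂ _+_ (∙-comm v u) (∙-comm w u)))

  ∙-++ : ∀ {k l} (u₁ v₁ : Vec ℤ k) (u₂ v₂ : Vec ℤ l) → (u₁ ++ u₂) ∙ (v₁ ++ v₂) ≡ u₁ ∙ v₁ + u₂ ∙ v₂
  ∙-++ []       []       u₂ v₂ = sym (ℤ.+-identityˡ (u₂ ∙ v₂))
  ∙-++ (x ∷ xs) (y ∷ ys) u₂ v₂ rewrite ∙-++ xs ys u₂ v₂ = sym (ℤ.+-assoc (x * y) (xs ∙ ys) (u₂ ∙ v₂))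

  ∙-zeroHead : ∀ {n} (x : Vec ℤ n) y → (0ℤ ∷ x) ∙ y ≡ x ∙ Vec.tail y
  ∙-zeroHead x (_ ∷ y) = ℤ.+-identityˡ (x ∙ y)

module TriangularSystems where

  open import Data.Nat using (ℕ; zero; suc; z≤n; s≤s; _≤_)
  import Data.Nat.Properties as ℕ
  open import Data.Integer using (ℤ; 0ℤ; _+_; _*_; -_; _≟_)
  import Data.Integer.Properties as ℤ
  open import Data.Integer.Solver using (module +-*-Solver)
  open import Data.Vec as Vec using (Vec; []; _∷_)
  open import Data.List as List using (List; []; _∷_; length)
  import Data.List.Properties as List
  open import Data.List.Relation.Unary.All as All using (All; []; _∷_)
  import Data.List.Relation.Unary.All.Properties as All
  open import Data.Fin as Fin using (Fin) renaming (_<_ to _<ᶠ_)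
  open import Data.Product using (_×_; _,_; proj₂)
  open import Data.Sum using (inj₁; inj₂)
  open import Data.Unit using (⊤)
  open import Function using (_∘_)
  open import Relation.Nullary using (yes; no; contradiction)
  open import Relation.Binary.PropositionalEquality
  open +-*-Solver
  open IntegerVectors

  Triangular : ∀ {n} → List (Vec ℤ n × Vec ℤ n) → Set
  Triangular []             = ⊤
  Triangular ((x , y) ∷ ps) = x ∙ y ≢ 0ℤ × All (λ q → x ∙ proj₂ q ≡ 0ℤ) ps × Triangular ps

  nonzero-* : ∀ {a b} → a ≢ 0ℤ → b ≢ 0ℤ → a * b ≢ 0ℤ
  nonzero-* {a} a≢0 b≢0 ab≡0 with ℤ.i*j≡0⇒i≡0∨j≡0 a ab≡0
  ... | inj₁ a≡0 = a≢0 a≡0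
  ... | inj₂ b≡0 = b≢0 b≡0

  -- With pivot row h ∷ x, the combination h (x₀ ∷ x′) - x₀ (h ∷ x) vanishes in the first
  -- coordinate; sweep returns its remaining coordinates.
  sweep : ∀ {n} → ℤ → Vec ℤ n → Vec ℤ (suc n) → Vec ℤ n
  sweep h x (x₀ ∷ x′) = h ·ᵥ x′ +ᵥ (- x₀) ·ᵥ x

  sweep-∙ : ∀ {n} h (x : Vec ℤ n) x′ y′ → (h ∷ x) ∙ y′ ≡ 0ℤ →
            sweep h x x′ ∙ Vec.tail y′ ≡ h * (x′ ∙ y′)
  sweep-∙ h x (x₀ ∷ x′) (y₀ ∷ y) e = begin
    (h ·ᵥ x′ +ᵥ (- x₀) ·ᵥ x) ∙ y          ≡⟨ ∙-+ˡ (h ·ᵥ x′) ((- x₀) ·ᵥ x) y ⟩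
    (h ·ᵥ x′) ∙ y + ((- x₀) ·ᵥ x) ∙ y     ≡⟨ cong₂ _+_ (∙-·ˡ h x′ y) (∙-·ˡ (- x₀) x y) ⟩
    h * (x′ ∙ y) + - x₀ * (x ∙ y)         ≡⟨ sym (ℤ.+-identityʳ _) ⟩
    h * (x′ ∙ y) + - x₀ * (x ∙ y) + 0ℤ
      ≡⟨ cong (h * (x′ ∙ y) + - x₀ * (x ∙ y) +_) (sym (trans (cong (x₀ *_) e) (ℤ.*-zeroʳ x₀))) ⟩
    h * (x′ ∙ y) + - x₀ * (x ∙ y) + x₀ * (h * y₀ + x ∙ y)
      ≡⟨ solve 5 (λ h x₀ y₀ a b → h :* a :+ :- x₀ :* b :+ x₀ :* (h :* y₀ :+ b) := h :* (x₀ :* y₀ :+ a))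
           refl h x₀ y₀ (x′ ∙ y) (x ∙ y) ⟩
    h * (x₀ * y₀ + x′ ∙ y)                ∎
    where open ≡-Reasoning

  sweepPair : ∀ {n} → ℤ → Vec ℤ n → Vec ℤ (suc n) × Vec ℤ (suc n) → Vec ℤ n × Vec ℤ n
  sweepPair h x (x′ , y′) = sweep h x x′ , Vec.tail y′

  -- Drops the first coordinate and at most one pair: the first one whose x starts with a
  -- nonzero entry, which becomes the pivot for all later pairs.
  eliminate : ∀ {n} → List (Vec ℤ (suc n) × Vec ℤ (suc n)) → List (Vec ℤ n × Vec ℤ n)
  eliminate []                     = []
  eliminate ((h ∷ x , _ ∷ y) ∷ ps) with h ≟ 0ℤ
  ... | yes _ = (x , y) ∷ eliminate ps
  ... | no  _ = List.map (sweepPair h x) ps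

  length-eliminate : ∀ {n} (ps : List (Vec ℤ (suc n) × Vec ℤ (suc n))) →
                     length ps ≤ suc (length (eliminate ps))
  length-eliminate []                     = z≤n
  length-eliminate ((h ∷ x , _ ∷ y) ∷ ps) with h ≟ 0ℤ
  ... | yes _ = s≤s (length-eliminate ps)
  ... | no  _ = s≤s (ℕ.≤-reflexive (sym (List.length-map (sweepPair h x) ps)))

  eliminate-All : ∀ {n} {P : Vec ℤ (suc n) → Set} {Q : Vec ℤ n → Set} →
                  (∀ {y} → P y → Q (Vec.tail y)) →
                  ∀ ps → All (P ∘ proj₂) ps → All (Q ∘ proj₂) (eliminate ps)
  eliminate-All f []                     []       = []
  eliminate-All f ((h ∷ x , _ ∷ y) ∷ ps) (p ∷ qs) with h ≟ 0ℤ
  ... | yes _ = f p ∷ eliminate-All f ps qs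
  ... | no  _ = All.map⁺ (All.map f qs)

  Triangular-sweep : ∀ {n h} {x : Vec ℤ n} → h ≢ 0ℤ → ∀ ps →
                     All (λ q → (h ∷ x) ∙ proj₂ q ≡ 0ℤ) ps → Triangular ps →
                     Triangular (List.map (sweepPair h x) ps)
  Triangular-sweep h≢0 [] [] _ = _
  Triangular-sweep {h = h} {x} h≢0 ((x′ , y′) ∷ ps) (e ∷ es) (d , o , t) =
    nonzero-* h≢0 d ∘ trans (sym (sweep-∙ h x x′ y′ e)) ,
    later es o ,
    Triangular-sweep h≢0 ps es t
    where
    later : ∀ {qs} → All (λ q → (h ∷ x) ∙ proj₂ q ≡ 0ℤ) qs → All (λ q → x′ ∙ proj₂ q ≡ 0ℤ) qs →
            All (λ q → sweep h x x′ ∙ proj₂ q ≡ 0ℤ) (List.map (sweepPair h x) qs)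
    later                [] [] = []
    later {(_ , y″) ∷ _} (e″ ∷ es″) (o″ ∷ os″) =
      trans (sweep-∙ h x x′ y″ e″) (trans (cong (h *_) o″) (ℤ.*-zeroʳ h)) ∷ later es″ os″

  Triangular-eliminate : ∀ {n} (ps : List (Vec ℤ (suc n) × Vec ℤ (suc n))) →
                         Triangular ps → Triangular (eliminate ps)
  Triangular-eliminate []                      _           = _
  Triangular-eliminate ((h ∷ x , y₀ ∷ y) ∷ ps) (d , o , t) with h ≟ 0ℤ
  ... | yes refl = d ∘ trans (∙-zeroHead x (y₀ ∷ y)) ,
                   eliminate-All (λ {y′} → trans (sym (∙-zeroHead x y′))) ps o ,
                   Triangular-eliminate ps t
  ... | no h≢0   = Triangular-sweep h≢0 ps o t

  triangular⇒length≤dim : ∀ n (ps : List (Vec ℤ n × Vec ℤ n)) → Triangular ps → length ps ≤ n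
  triangular⇒length≤dim zero    []              _       = z≤n
  triangular⇒length≤dim zero    (([] , []) ∷ _) (d , _) = contradiction refl d
  triangular⇒length≤dim (suc n) ps              t       = ℕ.≤-trans (length-eliminate ps)
    (s≤s (triangular⇒length≤dim n (eliminate ps) (Triangular-eliminate ps t)))

  Triangular-tabulate : ∀ {m n} (x y : Fin m → Vec ℤ n) →
                        (∀ i → x i ∙ y i ≢ 0ℤ) → (∀ i j → i <ᶠ j → x i ∙ y j ≡ 0ℤ) →
                        Triangular (List.tabulate (λ i → x i , y i))
  Triangular-tabulate {zero}  x y d o = _
  Triangular-tabulate {suc m} x y d o =
    d Fin.zero ,
    All.tabulate⁺ (λ j → o Fin.zero (Fin.suc j) (s≤s z≤n)) ,
    Triangular-tabulate (x ∘ Fin.suc) (y ∘ Fin.suc) (d ∘ Fin.suc)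
      (λ i j i<j → o (Fin.suc i) (Fin.suc j) (s≤s i<j))

  triangular⇒m≤dim : ∀ {m n} (x y : Fin m → Vec ℤ n) →
                     (∀ i → x i ∙ y i ≢ 0ℤ) → (∀ i j → i <ᶠ j → x i ∙ y j ≡ 0ℤ) → m ≤ n
  triangular⇒m≤dim {m} {n} x y d o =
    subst (_≤ n) (List.length-tabulate (λ i → x i , y i))
      (triangular⇒length≤dim n _ (Triangular-tabulate x y d o))

module Forms where

  open import Data.Nat using (ℕ; zero; suc) renaming (_+_ to _+ℕ_)
  open import Data.Integer using (ℤ; 0ℤ; 1ℤ; _+_; _*_)
  open import Data.Integer.Solver using (module +-*-Solver)
  open import Data.Vec as Vec using (Vec; []; _∷_; _++_)
  import Data.Vec.Properties as Vec
  open import Relation.Binary.PropositionalEquality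
  open +-*-Solver
  open IntegerVectors

  monomialCount : ℕ → ℕ → ℕ
  monomialCount n       zero    = 1
  monomialCount zero    (suc d) = 0
  monomialCount (suc n) (suc d) = monomialCount n (suc d) +ℕ monomialCount (suc n) d

  monomialCount-1 : ∀ d → monomialCount 1 d ≡ 1
  monomialCount-1 zero    = refl
  monomialCount-1 (suc d) = monomialCount-1 d

  monomialCount-2 : ∀ d → monomialCount 2 d ≡ suc d
  monomialCount-2 zero    = refl
  monomialCount-2 (suc d) = cong₂ _+ℕ_ (monomialCount-1 (suc d)) (monomialCount-2 d)

  -- A form of degree d in n variables is a coefficient vector u : Vec ℤ (monomialCount n d);
  -- its value at c is veronese c d ∙ u.
  veronese : ∀ {n} → Vec ℤ n → (d : ℕ) → Vec ℤ (monomialCount n d)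
  veronese c        zero    = 1ℤ ∷ []
  veronese []       (suc d) = []
  veronese (c₀ ∷ c) (suc d) = veronese c (suc d) ++ c₀ ·ᵥ veronese (c₀ ∷ c) d

  veronese-∙-split : ∀ {n d} (c₀ : ℤ) (c : Vec ℤ n) u →
    let k = monomialCount n (suc d) in
    veronese (c₀ ∷ c) (suc d) ∙ u ≡
    veronese c (suc d) ∙ Vec.take k u + c₀ * (veronese (c₀ ∷ c) d ∙ Vec.drop k u)
  veronese-∙-split {n} {d} c₀ c u = begin
    veronese (c₀ ∷ c) (suc d) ∙ u
      ≡⟨ cong (veronese (c₀ ∷ c) (suc d) ∙_) (sym (Vec.take++drop≡id k u)) ⟩
    veronese (c₀ ∷ c) (suc d) ∙ (Vec.take k u ++ Vec.drop k u)
      ≡⟨ ∙-++ (veronese c (suc d)) (Vec.take k u) (c₀ ·ᵥ veronese (c₀ ∷ c) d) (Vec.drop k u) ⟩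
    veronese c (suc d) ∙ Vec.take k u + (c₀ ·ᵥ veronese (c₀ ∷ c) d) ∙ Vec.drop k u
      ≡⟨ cong (veronese c (suc d) ∙ Vec.take k u +_) (∙-·ˡ c₀ (veronese (c₀ ∷ c) d) (Vec.drop k u)) ⟩
    veronese c (suc d) ∙ Vec.take k u + c₀ * (veronese (c₀ ∷ c) d ∙ Vec.drop k u) ∎
    where
    open ≡-Reasoning
    k = monomialCount n (suc d)

  -- Writing p = p₀ z₀ + p′ and u = u′ + z₀ u″ with p′ and u′ free of z₀,
  -- p u = p′ u′ + z₀ (p₀ u + p′ u″).
  linear* : ∀ {n} (d : ℕ) → Vec ℤ n → Vec ℤ (monomialCount n d) → Vec ℤ (monomialCount n (suc d))
  linear* d               []       u         = []
  linear* zero            (p₀ ∷ p) (u₀ ∷ []) = linear* zero p (u₀ ∷ []) ++ p₀ * u₀ ∷ []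
  linear* {suc n} (suc d) (p₀ ∷ p) u         =
    linear* (suc d) p (Vec.take (monomialCount n (suc d)) u) ++
    (p₀ ·ᵥ u +ᵥ linear* d (0ℤ ∷ p) (Vec.drop (monomialCount n (suc d)) u))

  linear*-eval : ∀ {n} d (p c : Vec ℤ n) u →
                 veronese c (suc d) ∙ linear* d p u ≡ (c ∙ p) * (veronese c d ∙ u)
  linear*-eval d       []       []       u         = refl
  linear*-eval zero    (p₀ ∷ p) (c₀ ∷ c) (u₀ ∷ []) = begin
    (veronese c 1 ++ c₀ ·ᵥ (1ℤ ∷ [])) ∙ (linear* zero p (u₀ ∷ []) ++ p₀ * u₀ ∷ [])
      ≡⟨ ∙-++ (veronese c 1) (linear* zero p (u₀ ∷ [])) _ _ ⟩
    veronese c 1 ∙ linear* zero p (u₀ ∷ []) + (c₀ * 1ℤ * (p₀ * u₀) + 0ℤ)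
      ≡⟨ cong (_+ (c₀ * 1ℤ * (p₀ * u₀) + 0ℤ)) (linear*-eval zero p c (u₀ ∷ [])) ⟩
    c ∙ p * (1ℤ * u₀ + 0ℤ) + (c₀ * 1ℤ * (p₀ * u₀) + 0ℤ)
      ≡⟨ solve 4 (λ a c₀ p₀ u₀ → a :* (con 1ℤ :* u₀ :+ con 0ℤ) :+ (c₀ :* con 1ℤ :* (p₀ :* u₀) :+ con 0ℤ)
                                := (c₀ :* p₀ :+ a) :* (con 1ℤ :* u₀ :+ con 0ℤ)) refl (c ∙ p) c₀ p₀ u₀ ⟩
    (c₀ * p₀ + c ∙ p) * (1ℤ * u₀ + 0ℤ) ∎
    where open ≡-Reasoning
  linear*-eval {suc n} (suc d) (p₀ ∷ p) (c₀ ∷ c) u = begin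
    (veronese c (suc (suc d)) ++ c₀ ·ᵥ V) ∙ (linear* (suc d) p u′ ++ (p₀ ·ᵥ u +ᵥ linear* d (0ℤ ∷ p) u″))
      ≡⟨ ∙-++ (veronese c (suc (suc d))) (linear* (suc d) p u′) (c₀ ·ᵥ V) _ ⟩
    veronese c (suc (suc d)) ∙ linear* (suc d) p u′ + (c₀ ·ᵥ V) ∙ (p₀ ·ᵥ u +ᵥ linear* d (0ℤ ∷ p) u″)
      ≡⟨ cong₂ _+_ (linear*-eval (suc d) p c u′) (trans (∙-·ˡ c₀ V _) (cong (c₀ *_) (trans
           (∙-+ʳ V (p₀ ·ᵥ u) _) (cong₂ _+_ (∙-·ʳ p₀ V u) (linear*-eval d (0ℤ ∷ p) (c₀ ∷ c) u″))))) ⟩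
    c ∙ p * a′ + c₀ * (p₀ * (V ∙ u) + (c₀ * 0ℤ + c ∙ p) * a″)
      ≡⟨ cong (λ v → c ∙ p * a′ + c₀ * (p₀ * v + (c₀ * 0ℤ + c ∙ p) * a″)) (veronese-∙-split c₀ c u) ⟩
    c ∙ p * a′ + c₀ * (p₀ * (a′ + c₀ * a″) + (c₀ * 0ℤ + c ∙ p) * a″)
      ≡⟨ solve 5 (λ a a′ a″ c₀ p₀ → a :* a′ :+ c₀ :* (p₀ :* (a′ :+ c₀ :* a″) :+ (c₀ :* con 0ℤ :+ a) :* a″)
                                   := (c₀ :* p₀ :+ a) :* (a′ :+ c₀ :* a″)) refl (c ∙ p) a′ a″ c₀ p₀ ⟩
    (c₀ * p₀ + c ∙ p) * (a′ + c₀ * a″)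
      ≡⟨ cong ((c₀ * p₀ + c ∙ p) *_) (sym (veronese-∙-split c₀ c u)) ⟩
    (c₀ * p₀ + c ∙ p) * (V ∙ u) ∎
    where
    open ≡-Reasoning
    k  = monomialCount n (suc d)
    V  = veronese (c₀ ∷ c) (suc d)
    u′ = Vec.take k u
    u″ = Vec.drop k u
    a′ = veronese c (suc d) ∙ u′
    a″ = veronese (c₀ ∷ c) d ∙ u″

  product : ∀ {d} → Vec ℤ d → ℤ
  product = Vec.foldr _ _*_ 1ℤ

  linearProduct : ∀ {n d} → Vec (Vec ℤ n) d → Vec ℤ (monomialCount n d)
  linearProduct             []       = 1ℤ ∷ []
  linearProduct {d = suc d} (p ∷ ps) = linear* d p (linearProduct ps)

  linearProduct-eval : ∀ {n d} (c : Vec ℤ n) (ps : Vec (Vec ℤ n) d) →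
                       veronese c d ∙ linearProduct ps ≡ product (Vec.map (c ∙_) ps)
  linearProduct-eval c []                   = refl
  linearProduct-eval {d = suc d} c (p ∷ ps) =
    trans (linear*-eval d p c (linearProduct ps)) (cong (c ∙ p *_) (linearProduct-eval c ps))

module SkewSetPairs where

  open import Data.Nat using (ℕ; zero; suc; s≤s; _≤_; _≤?_)
  import Data.Nat.Properties as ℕ
  open import Data.Integer using (ℤ; +_; -[1+_]; 0ℤ; 1ℤ; _+_; _*_; -_; _-_; _≟_)
  import Data.Integer.Properties as ℤ
  open import Data.Integer.Solver using (module +-*-Solver)
  open import Data.Vec as Vec using (Vec; []; _∷_)
  import Data.Vec.Properties as Vec
  open import Data.Vec.Membership.Propositional using () renaming (_∈_ to _∈ᵥ_)
  open import Data.Vec.Relation.Unary.Any using (here; there)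
  open import Data.List using (List; []; _∷_; length; concat; tabulate; _++_)
  open import Data.List.Membership.Propositional using (_∈_; mapWith∈)
  open import Data.List.Membership.Propositional.Properties using (∈-++⁺ˡ; ∈-++⁺ʳ; ∈-concat⁺′; ∈-tabulate⁺)
  import Data.List.Membership.Setoid.Properties as Membershipₛ
  open import Data.List.Relation.Unary.Any using (here; there)
  import Data.List.Relation.Unary.Any.Properties as Any
  open import Data.List.Relation.Binary.Subset.Propositional using (_⊆_)
  open import Data.Fin using (Fin) renaming (_<_ to _<ᶠ_)
  open import Data.Product using (_×_; _,_; ∃-syntax)
  open import Data.Sum using (_⊎_; inj₁; inj₂)
  open import Data.Empty using (⊥)
  open import Function using (_∘_)
  open import Relation.Nullary using (¬_; Dec; yes; no; contradiction)
  open import Relation.Nullary.Negation using (¬¬-map)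
  open import Relation.Nullary.Decidable using (decidable-stable; ¬¬-excluded-middle)
  open import Relation.Binary.PropositionalEquality
  open import Defs using (Disjoint)
  open +-*-Solver
  open IntegerVectors
  open TriangularSystems using (triangular⇒m≤dim)
  open Forms

  product-map≡0⇒ : ∀ {A : Set} {d} (f : A → ℤ) (v : Vec A d) →
                   product (Vec.map f v) ≡ 0ℤ → ∃[ x ] x ∈ᵥ v × f x ≡ 0ℤ
  product-map≡0⇒ f (x ∷ v) e with ℤ.i*j≡0⇒i≡0∨j≡0 (f x) e
  ... | inj₁ fx≡0 = x , here refl , fx≡0
  ... | inj₂ rest≡0 with product-map≡0⇒ f v rest≡0
  ...   | y , y∈v , fy≡0 = y , there y∈v , fy≡0

  ∈⇒product-map≡0 : ∀ {A : Set} {d} (f : A → ℤ) {x} {v : Vec A d} →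
                    x ∈ᵥ v → f x ≡ 0ℤ → product (Vec.map f v) ≡ 0ℤ
  ∈⇒product-map≡0 f {v = y ∷ v} (here refl) fx≡0 =
    cong (_* product (Vec.map f v)) fx≡0
  ∈⇒product-map≡0 f {v = y ∷ v} (there x∈v) fx≡0 =
    trans (cong (f y *_) (∈⇒product-map≡0 f x∈v fx≡0)) (ℤ.*-zeroʳ (f y))

  -- Binary forms of degree d stand for univariate polynomials of degree ≤ d, evaluated at
  -- b through the point (1 , b).
  point : ℤ → Vec ℤ 2
  point b = 1ℤ ∷ b ∷ []

  rootForm : ℤ → Vec ℤ 2
  rootForm a = - a ∷ 1ℤ ∷ []

  point-∙-rootForm : ∀ b a → point b ∙ rootForm a ≡ b - a
  point-∙-rootForm b a =
    solve 2 (λ b a → con 1ℤ :* (:- a) :+ (b :* con 1ℤ :+ con 0ℤ) := b :- a) refl b a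

  rootPolynomial : ∀ {a} → Vec ℤ a → Vec ℤ (monomialCount 2 a)
  rootPolynomial as = linearProduct (Vec.map rootForm as)

  evaluationAt : ∀ a → ℤ → Vec ℤ (monomialCount 2 a)
  evaluationAt a b = veronese (point b) a

  rootPolynomial-eval : ∀ {a} (as : Vec ℤ a) b →
                        rootPolynomial as ∙ evaluationAt a b ≡ product (Vec.map (λ x → b - x) as)
  rootPolynomial-eval {a} as b = begin
    rootPolynomial as ∙ evaluationAt a b                   ≡⟨ ∙-comm (rootPolynomial as) _ ⟩
    evaluationAt a b ∙ rootPolynomial as                   ≡⟨ linearProduct-eval (point b) (Vec.map rootForm as) ⟩
    product (Vec.map (point b ∙_) (Vec.map rootForm as))   ≡⟨ cong product (sym (Vec.map-∘ _ rootForm as)) ⟩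
    product (Vec.map (λ a → point b ∙ rootForm a) as)      ≡⟨ cong product (Vec.map-cong (point-∙-rootForm b) as) ⟩
    product (Vec.map (λ x → b - x) as)                     ∎
    where open ≡-Reasoning

  Disjointᵥ : ∀ {a b} → Vec ℤ a → Vec ℤ b → Set
  Disjointᵥ as bs = ∀ x → x ∈ᵥ as → x ∈ᵥ bs → ⊥

  embedLeft : ∀ {a} b → Vec ℤ a → Vec ℤ (monomialCount (monomialCount 2 a) b)
  embedLeft b as = veronese (rootPolynomial as) b

  embedRight : ∀ a {b} → Vec ℤ b → Vec ℤ (monomialCount (monomialCount 2 a) b)
  embedRight a bs = linearProduct (Vec.map (evaluationAt a) bs)

  embed-∙ : ∀ {a b} (as : Vec ℤ a) (bs : Vec ℤ b) →
            embedLeft b as ∙ embedRight a bs ≡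
            product (Vec.map (λ y → product (Vec.map (λ x → y - x) as)) bs)
  embed-∙ {a} {b} as bs = begin
    embedLeft b as ∙ embedRight a bs
      ≡⟨ linearProduct-eval (rootPolynomial as) (Vec.map (evaluationAt a) bs) ⟩
    product (Vec.map (rootPolynomial as ∙_) (Vec.map (evaluationAt a) bs))
      ≡⟨ cong product (sym (Vec.map-∘ _ (evaluationAt a) bs)) ⟩
    product (Vec.map (λ y → rootPolynomial as ∙ evaluationAt a y) bs)
      ≡⟨ cong product (Vec.map-cong (rootPolynomial-eval as) bs) ⟩
    product (Vec.map (λ y → product (Vec.map (λ x → y - x) as)) bs) ∎
    where open ≡-Reasoning

  embed-∙≡0⇒¬Disjointᵥ : ∀ {a b} (as : Vec ℤ a) (bs : Vec ℤ b) →
                     embedLeft b as ∙ embedRight a bs ≡ 0ℤ → ¬ Disjointᵥ as bs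
  embed-∙≡0⇒¬Disjointᵥ as bs e disjoint
    with y , y∈bs , e′ ← product-map≡0⇒ _ bs (trans (sym (embed-∙ as bs)) e)
    with x , x∈as , y-x≡0 ← product-map≡0⇒ _ as e′
    rewrite ℤ.i-j≡0⇒i≡j y x y-x≡0 = disjoint x x∈as y∈bs

  common⇒embed-∙≡0 : ∀ {a b x} (as : Vec ℤ a) (bs : Vec ℤ b) →
                     x ∈ᵥ as → x ∈ᵥ bs → embedLeft b as ∙ embedRight a bs ≡ 0ℤ
  common⇒embed-∙≡0 {x = x} as bs x∈as x∈bs = trans (embed-∙ as bs)
    (∈⇒product-map≡0 _ x∈bs (∈⇒product-map≡0 (λ z → x - z) x∈as (ℤ.+-inverseʳ x)))

  skewSetPairsᵥ : ∀ {m a b} (A : Fin m → Vec ℤ a) (B : Fin m → Vec ℤ b) →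
                  (∀ i → Disjointᵥ (A i) (B i)) → (∀ i j → i <ᶠ j → ¬ Disjointᵥ (A i) (B j)) →
                  m ≤ monomialCount (suc a) b
  skewSetPairsᵥ {m} {a} {b} A B disjoint meet =
    subst (λ n → m ≤ monomialCount n b) (monomialCount-2 a)
      (triangular⇒m≤dim (embedLeft b ∘ A) (embedRight a ∘ B) diagonal aboveDiagonal)
    where
    diagonal : ∀ i → embedLeft b (A i) ∙ embedRight a (B i) ≢ 0ℤ
    diagonal i e = embed-∙≡0⇒¬Disjointᵥ (A i) (B i) e (disjoint i)
    aboveDiagonal : ∀ i j → i <ᶠ j → embedLeft b (A i) ∙ embedRight a (B j) ≡ 0ℤ
    aboveDiagonal i j i<j = decidable-stable (_ ≟ 0ℤ) λ ≢0 →
      meet i j i<j (λ x x∈A x∈B → ≢0 (common⇒embed-∙≡0 (A i) (B j) x∈A x∈B))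

  padTo : ∀ {A : Set} k → A → List A → Vec A k
  padTo zero    d _        = []
  padTo (suc k) d []       = d ∷ padTo k d []
  padTo (suc k) d (x ∷ xs) = x ∷ padTo k d xs

  ∈-padTo⁻ : ∀ {A : Set} k {d x : A} xs → x ∈ᵥ padTo k d xs → x ∈ xs ⊎ x ≡ d
  ∈-padTo⁻ (suc k) []       (here refl)  = inj₂ refl
  ∈-padTo⁻ (suc k) []       (there x∈)   = ∈-padTo⁻ k [] x∈
  ∈-padTo⁻ (suc k) (y ∷ xs) (here refl)  = inj₁ (here refl)
  ∈-padTo⁻ (suc k) (y ∷ xs) (there x∈) with ∈-padTo⁻ k xs x∈
  ... | inj₁ x∈xs = inj₁ (there x∈xs)
  ... | inj₂ x≡d  = inj₂ x≡d

  ∈-padTo⁺ : ∀ {A : Set} {k} {d x : A} {xs} → x ∈ xs → length xs ≤ k → x ∈ᵥ padTo k d xs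
  ∈-padTo⁺ (here refl) (s≤s _)  = here refl
  ∈-padTo⁺ (there x∈)  (s≤s len) = there (∈-padTo⁺ x∈ len)

  record Labelling {X : Set} (E : List X) : Set where
    field
      label            : ∀ {x} → x ∈ E → ℕ
      label-injective  : ∀ {x y} (p : x ∈ E) (q : y ∈ E) → label p ≡ label q → x ≡ y
      label-irrelevant : ∀ {x} (p q : x ∈ E) → label p ≡ label q

  Labelling-∷ : ∀ {X : Set} {e : X} {E} → Labelling E → Dec (e ∈ E) → Labelling (e ∷ E)
  Labelling-∷ {e = e} {E} L (yes e∈E) =
    record { label = label′ ; label-injective = injective ; label-irrelevant = irrelevant }
    where
    open Labelling L
    label′ : ∀ {x} → x ∈ e ∷ E → ℕ
    label′ (here refl) = label e∈E
    label′ (there p)   = label p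
    injective : ∀ {x y} (p : x ∈ e ∷ E) (q : y ∈ e ∷ E) → label′ p ≡ label′ q → x ≡ y
    injective (here refl) (here refl) _ = refl
    injective (here refl) (there q)   = label-injective e∈E q
    injective (there p)   (here refl) = label-injective p e∈E
    injective (there p)   (there q)   = label-injective p q
    irrelevant : ∀ {x} (p q : x ∈ e ∷ E) → label′ p ≡ label′ q
    irrelevant (here refl) (here refl) = refl
    irrelevant (here refl) (there q)   = label-irrelevant e∈E q
    irrelevant (there p)   (here refl) = label-irrelevant p e∈E
    irrelevant (there p)   (there q)   = label-irrelevant p q
  Labelling-∷ {e = e} {E} L (no e∉E) =
    record { label = label′ ; label-injective = injective ; label-irrelevant = irrelevant }
    where
    open Labelling L
    label′ : ∀ {x} → x ∈ e ∷ E → ℕ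
    label′ (here _)  = zero
    label′ (there p) = suc (label p)
    injective : ∀ {x y} (p : x ∈ e ∷ E) (q : y ∈ e ∷ E) → label′ p ≡ label′ q → x ≡ y
    injective (here refl) (here refl) _  = refl
    injective (there p)   (there q)   eq = label-injective p q (ℕ.suc-injective eq)
    irrelevant : ∀ {x} (p q : x ∈ e ∷ E) → label′ p ≡ label′ q
    irrelevant (here refl) (here refl) = refl
    irrelevant (here refl) (there q)   = contradiction q e∉E
    irrelevant (there p)   (here refl) = contradiction p e∉E
    irrelevant (there p)   (there q)   = cong suc (label-irrelevant p q)

  -- Without decidable equality on X a labelling need not exist, but it cannot fail to exist:
  -- extending it from E to e ∷ E only needs to know whether e ∈ E.
  ¬¬labelling : ∀ {X : Set} (E : List X) → ¬ ¬ Labelling E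
  ¬¬labelling []      k = k (record { label = λ (); label-injective = λ (); label-irrelevant = λ () })
  ¬¬labelling (e ∷ E) k = ¬¬labelling E λ L → ¬¬-excluded-middle (k ∘ Labelling-∷ L)

  module _ {X : Set} {E : List X} (L : Labelling E) where

    open Labelling L

    -- The paddings -1 and -2 used below differ from each other and from the nonnegative codes
    -- + label p, so padding creates no common entries.
    encode : (k : ℕ) → ℕ → (xs : List X) → xs ⊆ E → Vec ℤ k
    encode k pad xs xs⊆E = padTo k -[1+ pad ] (mapWith∈ xs (λ x∈xs → + label (xs⊆E x∈xs)))

    encode-Disjoint⁺ : ∀ {a b xs ys} {xs⊆E : xs ⊆ E} {ys⊆E : ys ⊆ E} → Disjoint xs ys →
                       Disjointᵥ (encode a 0 xs xs⊆E) (encode b 1 ys ys⊆E)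
    encode-Disjoint⁺ {a} {b} {xs} {ys} disjoint z z∈A z∈B with ∈-padTo⁻ a _ z∈A | ∈-padTo⁻ b _ z∈B
    ... | inj₂ refl | inj₂ ()
    ... | inj₂ refl | inj₁ z∈ys′ with _ , _ , () ← Any.mapWith∈⁻ ys _ z∈ys′
    ... | inj₁ z∈xs′ | inj₂ refl with _ , _ , () ← Any.mapWith∈⁻ xs _ z∈xs′
    ... | inj₁ z∈xs′ | inj₁ z∈ys′
      with x , x∈xs , refl ← Any.mapWith∈⁻ xs _ z∈xs′
         | y , y∈ys , eq   ← Any.mapWith∈⁻ ys _ z∈ys′
      = disjoint x x∈xs (subst (_∈ ys) (sym (label-injective _ _ (ℤ.+-injective eq))) y∈ys)

    encode-Disjoint⁻ : ∀ {a b xs ys} {xs⊆E : xs ⊆ E} {ys⊆E : ys ⊆ E} →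
                       length xs ≤ a → length ys ≤ b →
                       Disjointᵥ (encode a 0 xs xs⊆E) (encode b 1 ys ys⊆E) → Disjoint xs ys
    encode-Disjoint⁻ {xs = xs} {ys} {xs⊆E} {ys⊆E} |xs|≤a |ys|≤b disjoint x x∈xs x∈ys =
      disjoint (+ label (xs⊆E x∈xs))
        (∈-padTo⁺ (Any.mapWith∈⁺ _ (x , x∈xs , refl)) (length-codes xs |xs|≤a))
        (∈-padTo⁺ (Any.mapWith∈⁺ _ (x , x∈ys , cong +_ (label-irrelevant _ _))) (length-codes ys |ys|≤b))
      where
      length-codes : ∀ zs {k} {f : ∀ {z} → z ∈ zs → ℤ} → length zs ≤ k → length (mapWith∈ zs f) ≤ k
      length-codes zs |zs|≤k = subst (_≤ _) (sym (Membershipₛ.length-mapWith∈ (setoid X) zs)) |zs|≤k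

  skewSetPairs : ∀ {X : Set} {m a b} (A B : Fin m → List X) →
                 (∀ i → length (A i) ≤ a) → (∀ i → length (B i) ≤ b) →
                 (∀ i → Disjoint (A i) (B i)) → (∀ i j → i <ᶠ j → ¬ Disjoint (A i) (B j)) →
                 m ≤ monomialCount (suc a) b
  skewSetPairs {m = m} {a} {b} A B |A|≤a |B|≤b disjoint meet =
    decidable-stable (m ≤? monomialCount (suc a) b) (¬¬-map bound (¬¬labelling E))
    where
    E = concat (tabulate (λ i → A i ++ B i))
    A⊆E : ∀ i → A i ⊆ E
    A⊆E i x∈ = ∈-concat⁺′ (∈-++⁺ˡ x∈) (∈-tabulate⁺ i)
    B⊆E : ∀ i → B i ⊆ E
    B⊆E i x∈ = ∈-concat⁺′ (∈-++⁺ʳ (A i) x∈) (∈-tabulate⁺ i)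
    bound : Labelling E → m ≤ monomialCount (suc a) b
    bound L = skewSetPairsᵥ (λ i → encode L a 0 (A i) (A⊆E i)) (λ i → encode L b 1 (B i) (B⊆E i))
      (λ i → encode-Disjoint⁺ L (disjoint i))
      (λ i j i<j → meet i j i<j ∘ encode-Disjoint⁻ L (|A|≤a i) (|B|≤b j))

module Codes where

  open import Data.Nat using (ℕ; zero; suc; z≤n; s≤s; _+_; _∸_; _≤_; _<_; _≤?_)
  import Data.Nat.Properties as ℕ
  open import Data.List as List using (List; []; _∷_; length; take; drop; upTo; _++_)
  import Data.List.Properties as List
  open import Data.List.Membership.Propositional using (_∈_)
  open import Data.List.Membership.Propositional.Properties
    using (∈-++⁻; ∈-++⁺ˡ; ∈-++⁺ʳ; ∈-map⁺; ∈-map⁻; ∈-upTo⁺; ∈-upTo⁻)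
  open import Data.List.Relation.Unary.Any using (here; there)
  open import Data.Fin using (toℕ; fromℕ<)
  import Data.Fin.Properties as Fin
  open import Data.Product using (_×_; _,_; ∃-syntax)
  open import Data.Sum using (inj₁; inj₂)
  open import Relation.Nullary using (yes; no)
  open import Relation.Binary.PropositionalEquality
  open import Defs using (Disjoint; Compatible)

  suffixCodes : ∀ {A : Set} → List A → List (A × ℕ)
  suffixCodes []       = []
  suffixCodes (x ∷ xs) = (x , length xs) ∷ suffixCodes xs

  prefixCodes : ∀ {A : Set} → ℕ → List A → List (A × ℕ)
  prefixCodes zero    _        = []
  prefixCodes (suc c) []       = []
  prefixCodes (suc c) (y ∷ ys) = List.map (y ,_) (upTo (suc c)) ++ prefixCodes c ys

  triangular : ℕ → ℕ
  triangular zero    = 0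
  triangular (suc c) = suc c + triangular c

  length-suffixCodes : ∀ {A : Set} (σ : List A) → length (suffixCodes σ) ≡ length σ
  length-suffixCodes []       = refl
  length-suffixCodes (x ∷ xs) = cong suc (length-suffixCodes xs)

  length-prefixCodes : ∀ {A : Set} c (ρ : List A) → length (prefixCodes c ρ) ≤ triangular c
  length-prefixCodes zero    _        = z≤n
  length-prefixCodes (suc c) []       = z≤n
  length-prefixCodes (suc c) (y ∷ ys) = begin
    length (List.map (y ,_) (upTo (suc c)) ++ prefixCodes c ys)
      ≡⟨ List.length-++ (List.map (y ,_) (upTo (suc c))) ⟩
    length (List.map (y ,_) (upTo (suc c))) + length (prefixCodes c ys)
      ≡⟨ cong (_+ length (prefixCodes c ys))
           (trans (List.length-map (y ,_) (upTo (suc c))) (List.length-upTo (suc c))) ⟩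
    suc c + length (prefixCodes c ys)
      ≤⟨ ℕ.+-monoʳ-≤ (suc c) (length-prefixCodes c ys) ⟩
    suc c + triangular c ∎
    where open ℕ.≤-Reasoning

  ∈-suffixCodes⁻ : ∀ {A : Set} {x : A} {q} σ → (x , q) ∈ suffixCodes σ →
                   q < length σ × x ∈ drop (length σ ∸ suc q) σ
  ∈-suffixCodes⁻ {x = x} (y ∷ ys) (here refl) =
    ℕ.n<1+n (length ys) , subst (λ n → x ∈ drop n (x ∷ ys)) (sym (ℕ.n∸n≡0 (length ys))) (here refl)
  ∈-suffixCodes⁻ {x = x} (y ∷ ys) (there p) with q<len , x∈drop ← ∈-suffixCodes⁻ ys p =
    ℕ.m<n⇒m<1+n q<len , subst (λ n → x ∈ drop n (y ∷ ys)) (sym (ℕ.+-∸-assoc 1 q<len)) x∈drop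

  ∈-suffixCodes⁺ : ∀ {A : Set} {x : A} σ j → x ∈ drop (length σ ∸ j) σ →
                   ∃[ q ] q < j × (x , q) ∈ suffixCodes σ
  ∈-suffixCodes⁺ [] zero    ()
  ∈-suffixCodes⁺ [] (suc j) ()
  ∈-suffixCodes⁺ {x = x} (y ∷ ys) j x∈ with j ≤? length ys
  ... | yes j≤len with q , q<j , p ← ∈-suffixCodes⁺ ys j
                                     (subst (λ n → x ∈ drop n (y ∷ ys)) (ℕ.+-∸-assoc 1 j≤len) x∈)
    = q , q<j , there p
  ... | no j≰len with subst (λ n → x ∈ drop n (y ∷ ys)) (ℕ.m≤n⇒m∸n≡0 (ℕ.≰⇒> j≰len)) x∈
  ...   | here refl = length ys , ℕ.≰⇒> j≰len , here refl
  ...   | there x∈ys with q , q<j , p ← ∈-suffixCodes⁺ ys j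
                          (subst (λ n → x ∈ drop n ys) (sym (ℕ.m≤n⇒m∸n≡0 (ℕ.<⇒≤ (ℕ.≰⇒> j≰len)))) x∈ys)
    = q , q<j , there p

  take-suc-∸ : ∀ {A : Set} {q c} (y : A) ys → q ≤ c → take (suc c ∸ q) (y ∷ ys) ≡ y ∷ take (c ∸ q) ys
  take-suc-∸ y ys q≤c = cong (λ n → take n (y ∷ ys)) (ℕ.+-∸-assoc 1 q≤c)

  ∈-prefixCodes⁻ : ∀ {A : Set} {y : A} {q} c ρ → (y , q) ∈ prefixCodes c ρ →
                   q < c × y ∈ take (c ∸ q) ρ
  ∈-prefixCodes⁻ {y = y} {q} (suc c) (y′ ∷ ys) p with ∈-++⁻ (List.map (y′ ,_) (upTo (suc c))) p
  ... | inj₁ p′ with _ , q∈ , refl ← ∈-map⁻ (y′ ,_) p′ =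
    ∈-upTo⁻ q∈ , subst (y ∈_) (sym (take-suc-∸ y ys (ℕ.≤-pred (∈-upTo⁻ q∈)))) (here refl)
  ... | inj₂ p′ with q<c , y∈take ← ∈-prefixCodes⁻ c ys p′ =
    ℕ.m<n⇒m<1+n q<c , subst (y ∈_) (sym (take-suc-∸ y′ ys (ℕ.<⇒≤ q<c))) (there y∈take)

  ∈-prefixCodes⁺ : ∀ {A : Set} {y : A} {q} c ρ n → y ∈ take n ρ → n + q ≤ c →
                   (y , q) ∈ prefixCodes c ρ
  ∈-prefixCodes⁺ {y = y} (suc c) (y ∷ ys) (suc n) (here refl) (s≤s n+q≤c) =
    ∈-++⁺ˡ (∈-map⁺ (y ,_) (∈-upTo⁺ (s≤s (ℕ.m+n≤o⇒n≤o n n+q≤c))))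
  ∈-prefixCodes⁺ (suc c) (y′ ∷ ys) (suc n) (there y∈) (s≤s n+q≤c) =
    ∈-++⁺ʳ (List.map (y′ ,_) (upTo (suc c))) (∈-prefixCodes⁺ c ys n y∈ n+q≤c)

  window : ∀ {q r} → q < r → r ∸ suc q + 1 ≡ r ∸ q
  window {q} {r} q<r = trans (ℕ.+-comm (r ∸ suc q) 1) (sym (ℕ.+-∸-assoc 1 q<r))

  compatible⇒disjoint : ∀ {A : Set} {r} {σ ρ : List A} →
                        Compatible r σ ρ → Disjoint (suffixCodes σ) (prefixCodes r ρ)
  compatible⇒disjoint {r = r} {σ} {ρ} compatible (x , q) s∈ p∈
    with q<r , x∈take ← ∈-prefixCodes⁻ r ρ p∈
    with _ , x∈drop ← ∈-suffixCodes⁻ σ s∈ =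
    compatible k x
      (subst (λ j → x ∈ drop (length σ ∸ suc j) σ) (sym k≡q) x∈drop)
      (subst (λ j → x ∈ take (r ∸ suc j + 1) ρ) (sym k≡q)
        (subst (λ n → x ∈ take n ρ) (sym (window q<r)) x∈take))
    where
    k   = fromℕ< q<r
    k≡q = Fin.toℕ-fromℕ< q<r

  disjoint⇒compatible : ∀ {A : Set} {r} {σ ρ : List A} →
                        Disjoint (suffixCodes σ) (prefixCodes r ρ) → Compatible r σ ρ
  disjoint⇒compatible {r = r} {σ} {ρ} disjoint k x x∈drop x∈take
    with q , s≤s q≤k , s∈ ← ∈-suffixCodes⁺ σ (suc (toℕ k)) x∈drop =
    disjoint (x , q) s∈ (∈-prefixCodes⁺ r ρ _ x∈take (begin
      r ∸ suc (toℕ k) + 1 + q ≡⟨ cong (_+ q) (window (Fin.toℕ<n k)) ⟩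
      r ∸ toℕ k + q           ≤⟨ ℕ.+-monoʳ-≤ (r ∸ toℕ k) q≤k ⟩
      r ∸ toℕ k + toℕ k       ≡⟨ ℕ.m∸n+n≡m (ℕ.<⇒≤ (Fin.toℕ<n k)) ⟩
      r                       ∎))
    where open ℕ.≤-Reasoning

module Estimates where

  open import Data.Nat
  open import Data.Nat.Properties
  open import Data.Nat.Solver using (module +-*-Solver)
  open import Data.Nat.Divisibility using (m≤n⇒m!∣n!)
  open import Data.Nat.DivMod using (m/n*n≡m)
  open import Data.Nat.ListAction using (sum)
  open import Data.List using (map; upTo; applyUpTo)
  open import Data.Product using (_×_; _,_; ∃-syntax)
  open import Data.Unit using (tt)
  open import Relation.Binary.PropositionalEquality
  open +-*-Solver
  open import Defs using (eNum; eDen; LeREPowR)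
  open Forms using (monomialCount; monomialCount-1)
  open Codes using (triangular)

  ^-distribʳ-* : ∀ m n o → (m * n) ^ o ≡ m ^ o * n ^ o
  ^-distribʳ-* m n zero    = refl
  ^-distribʳ-* m n (suc o) rewrite ^-distribʳ-* m n o =
    solve 4 (λ m n x y → (m :* n) :* (x :* y) := (m :* x) :* (n :* y)) refl m n (m ^ o) (n ^ o)

  n!≤nⁿ : ∀ n → n ! ≤ n ^ n
  n!≤nⁿ zero    = ≤-refl
  n!≤nⁿ (suc n) = *-monoʳ-≤ (suc n) (≤-trans (n!≤nⁿ n) (^-monoˡ-≤ n (n≤1+n n)))

  bernoulli : ∀ s k → s ^ suc k + suc k * s ^ k ≤ suc s ^ suc k
  bernoulli s zero    =
    ≤-reflexive (solve 1 (λ s → s :* con 1 :+ con 1 :* con 1 := (con 1 :+ s) :* con 1) refl s)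
  bernoulli s (suc k) = begin
    s * (s * s ^ k) + (2 + k) * (s * s ^ k)                   ≤⟨ m≤m+n _ ((1 + k) * s ^ k) ⟩
    s * (s * s ^ k) + (2 + k) * (s * s ^ k) + (1 + k) * s ^ k
      ≡⟨ solve 3 (λ s k x → s :* (s :* x) :+ (con 2 :+ k) :* (s :* x) :+ (con 1 :+ k) :* x
                          := (con 1 :+ s) :* (s :* x :+ (con 1 :+ k) :* x)) refl s k (s ^ k) ⟩
    suc s * (s ^ suc k + suc k * s ^ k)                       ≤⟨ *-monoʳ-≤ (suc s) (bernoulli s k) ⟩
    suc s ^ suc (suc k)                                       ∎
    where open ≤-Reasoning

  -- monomialCount (suc n) d = (n + d) choose n
  monomialCount-bound : ∀ n d → monomialCount (suc n) d * n ! ≤ (n + d) ^ n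
  monomialCount-bound n       zero    = begin
    1 * n !       ≡⟨ *-identityˡ (n !) ⟩
    n !           ≤⟨ n!≤nⁿ n ⟩
    n ^ n         ≡⟨ cong (_^ n) (sym (+-identityʳ n)) ⟩
    (n + 0) ^ n   ∎
    where open ≤-Reasoning
  monomialCount-bound zero    (suc d) = ≤-reflexive (cong (_* 1) (monomialCount-1 d))
  monomialCount-bound (suc n) (suc d) = begin
    (a + b) * (suc n * n !)
      ≡⟨ solve 4 (λ a b n f → (a :+ b) :* ((con 1 :+ n) :* f)
                            := (con 1 :+ n) :* (a :* f) :+ b :* ((con 1 :+ n) :* f)) refl a b n (n !) ⟩
    suc n * (a * n !) + b * (suc n * n !)
      ≤⟨ +-mono-≤ (*-monoʳ-≤ (suc n) (monomialCount-bound n (suc d))) (monomialCount-bound (suc n) d) ⟩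
    suc n * s ^ n + (suc n + d) ^ suc n
      ≡⟨ cong (λ z → suc n * s ^ n + z ^ suc n) (sym (+-suc n d)) ⟩
    suc n * s ^ n + s ^ suc n
      ≤⟨ ≤-trans (≤-reflexive (+-comm (suc n * s ^ n) (s ^ suc n))) (bernoulli s n) ⟩
    suc s ^ suc n ∎
    where
    open ≤-Reasoning
    a = monomialCount (suc n) (suc d)
    b = monomialCount (suc (suc n)) d
    s = n + suc d

  bernoulli′ : ∀ j t → suc (j + t) ^ j * suc t ≤ suc (j + t) * (j + t) ^ j
  bernoulli′ zero    t = ≤-reflexive (*-comm 1 (suc t))
  bernoulli′ (suc j) t = begin
    (2 + a) * p * (1 + t)
      ≡⟨ solve 3 (λ a p t → (con 2 :+ a) :* p :* (con 1 :+ t) := p :* ((con 2 :+ a) :* (con 1 :+ t))) refl a p t ⟩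
    p * ((2 + a) * (1 + t))
      ≤⟨ *-monoʳ-≤ p (≤-trans (m≤m+n _ j) (≤-reflexive
           (solve 2 (λ j t → (con 2 :+ (j :+ t)) :* (con 1 :+ t) :+ j := (con 1 :+ (j :+ t)) :* (con 2 :+ t))
              refl j t))) ⟩
    p * ((1 + a) * (2 + t))
      ≡⟨ solve 3 (λ a p t → p :* ((con 1 :+ a) :* (con 2 :+ t)) := (con 1 :+ a) :* (p :* (con 2 :+ t))) refl a p t ⟩
    (1 + a) * (p * (2 + t))
      ≤⟨ *-monoʳ-≤ (1 + a) (subst (λ z → suc z ^ j * (2 + t) ≤ suc z * z ^ j) (+-suc j t) (bernoulli′ j (suc t))) ⟩
    (1 + a) * ((2 + a) * (1 + a) ^ j)
      ≡⟨ solve 3 (λ a q p → (con 1 :+ a) :* ((con 2 :+ a) :* q) := (con 2 :+ a) :* ((con 1 :+ a) :* q))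
           refl a ((1 + a) ^ j) p ⟩
    (2 + a) * ((1 + a) * (1 + a) ^ j) ∎
    where
    open ≤-Reasoning
    a = j + t
    p = (2 + a) ^ j

  half : ∀ j t → j ≤ suc t → suc (j + t) ^ j ≤ 2 * (j + t) ^ j
  half j t j≤1+t = *-cancelʳ-≤ (suc k ^ j) (2 * k ^ j) (suc k) (begin
    suc k ^ j * suc k
      ≤⟨ *-monoʳ-≤ (suc k ^ j) 1+k≤2[1+t] ⟩
    suc k ^ j * (2 * suc t)
      ≡⟨ solve 2 (λ p t → p :* (con 2 :* (con 1 :+ t)) := con 2 :* (p :* (con 1 :+ t))) refl (suc k ^ j) t ⟩
    2 * (suc k ^ j * suc t)
      ≤⟨ *-monoʳ-≤ 2 (bernoulli′ j t) ⟩
    2 * (suc k * k ^ j)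
      ≡⟨ solve 2 (λ k x → con 2 :* ((con 1 :+ k) :* x) := con 2 :* x :* (con 1 :+ k)) refl k (k ^ j) ⟩
    2 * k ^ j * suc k ∎)
    where
    open ≤-Reasoning
    k = j + t
    1+k≤2[1+t] : suc k ≤ 2 * suc t
    1+k≤2[1+t] = begin
      suc (j + t)        ≡⟨ sym (+-suc j t) ⟩
      j + suc t          ≤⟨ +-monoˡ-≤ (suc t) j≤1+t ⟩
      suc t + suc t      ≡⟨ cong (suc t +_) (sym (+-identityʳ (suc t))) ⟩
      2 * suc t          ∎

  halves : ∀ k → ∃[ a ] ∃[ b ] a + b ≡ k × b ≤ a × a ≤ suc b
  halves zero    = 0 , 0 , refl , z≤n , z≤n
  halves (suc k) with a , b , a+b≡k , b≤a , a≤1+b ← halves k =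
    suc b , a , cong suc (trans (+-comm b a) a+b≡k) , a≤1+b , s≤s b≤a

  [1+k]^k≤4*k^k : ∀ k → suc k ^ k ≤ 4 * k ^ k
  [1+k]^k≤4*k^k k with a , b , refl , b≤a , a≤1+b ← halves k = begin
    suc (a + b) ^ (a + b)
      ≡⟨ ^-distribˡ-+-* (suc (a + b)) a b ⟩
    suc (a + b) ^ a * suc (a + b) ^ b
      ≤⟨ *-mono-≤ (half a b a≤1+b) (subst (λ z → suc z ^ b ≤ 2 * z ^ b) (+-comm b a) (half b a (m≤n⇒m≤1+n b≤a))) ⟩
    (2 * (a + b) ^ a) * (2 * (a + b) ^ b)
      ≡⟨ solve 2 (λ x y → (con 2 :* x) :* (con 2 :* y) := con 4 :* (x :* y)) refl ((a + b) ^ a) ((a + b) ^ b) ⟩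
    4 * ((a + b) ^ a * (a + b) ^ b)
      ≡⟨ cong (4 *_) (sym (^-distribˡ-+-* (a + b) a b)) ⟩
    4 * (a + b) ^ (a + b) ∎
    where open ≤-Reasoning

  nⁿ≤4ⁿ*n! : ∀ n → n ^ n ≤ 4 ^ n * n !
  nⁿ≤4ⁿ*n! zero    = ≤-refl
  nⁿ≤4ⁿ*n! (suc n) = begin
    suc n * suc n ^ n
      ≤⟨ *-monoʳ-≤ (suc n) ([1+k]^k≤4*k^k n) ⟩
    suc n * (4 * n ^ n)
      ≤⟨ *-monoʳ-≤ (suc n) (*-monoʳ-≤ 4 (nⁿ≤4ⁿ*n! n)) ⟩
    suc n * (4 * (4 ^ n * n !))
      ≡⟨ solve 3 (λ n x y → (con 1 :+ n) :* (con 4 :* (x :* y)) := (con 4 :* x) :* ((con 1 :+ n) :* y))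
           refl n (4 ^ n) (n !) ⟩
    4 ^ suc n * suc n ! ∎
    where open ≤-Reasoning

  -- 20 (r + 3) ≤ 27 r holds from r = 9 on; the smaller cases are evaluated.
  [5[r+3]]^r≤27^r*r! : ∀ r → (5 * (r + 3)) ^ r ≤ 27 ^ r * r !
  [5[r+3]]^r≤27^r*r! 0 = ≤ᵇ⇒≤ _ _ tt
  [5[r+3]]^r≤27^r*r! 1 = ≤ᵇ⇒≤ _ _ tt
  [5[r+3]]^r≤27^r*r! 2 = ≤ᵇ⇒≤ _ _ tt
  [5[r+3]]^r≤27^r*r! 3 = ≤ᵇ⇒≤ _ _ tt
  [5[r+3]]^r≤27^r*r! 4 = ≤ᵇ⇒≤ _ _ tt
  [5[r+3]]^r≤27^r*r! 5 = ≤ᵇ⇒≤ _ _ tt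
  [5[r+3]]^r≤27^r*r! 6 = ≤ᵇ⇒≤ _ _ tt
  [5[r+3]]^r≤27^r*r! 7 = ≤ᵇ⇒≤ _ _ tt
  [5[r+3]]^r≤27^r*r! 8 = ≤ᵇ⇒≤ _ _ tt
  [5[r+3]]^r≤27^r*r! r@(suc (suc (suc (suc (suc (suc (suc (suc (suc t))))))))) =
    *-cancelʳ-≤ ((5 * (r + 3)) ^ r) (27 ^ r * r !) (4 ^ r) {{m^n≢0 4 r}} (begin
      (5 * (r + 3)) ^ r * 4 ^ r    ≡⟨ sym (^-distribʳ-* (5 * (r + 3)) 4 r) ⟩
      (5 * (r + 3) * 4) ^ r        ≤⟨ ^-monoˡ-≤ r 20[r+3]≤27r ⟩
      (27 * r) ^ r                 ≡⟨ ^-distribʳ-* 27 r r ⟩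
      27 ^ r * r ^ r               ≤⟨ *-monoʳ-≤ (27 ^ r) (nⁿ≤4ⁿ*n! r) ⟩
      27 ^ r * (4 ^ r * r !)       ≡⟨ solve 3 (λ a b c → a :* (b :* c) := a :* c :* b) refl (27 ^ r) (4 ^ r) (r !) ⟩
      27 ^ r * r ! * 4 ^ r         ∎)
    where
    open ≤-Reasoning
    20[r+3]≤27r : 5 * (r + 3) * 4 ≤ 27 * r
    20[r+3]≤27r = ≤-trans (m≤m+n _ (3 + 7 * t)) (≤-reflexive
      (solve 1 (λ t → con 5 :* ((con 9 :+ t) :+ con 3) :* con 4 :+ (con 3 :+ con 7 :* t) := con 27 :* (con 9 :+ t))
         refl t))

  2*triangular : ∀ r → 2 * triangular r ≡ r * suc r
  2*triangular zero    = refl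
  2*triangular (suc r) = begin
    2 * (suc r + triangular r)        ≡⟨ *-distribˡ-+ 2 (suc r) (triangular r) ⟩
    2 * suc r + 2 * triangular r      ≡⟨ cong (2 * suc r +_) (2*triangular r) ⟩
    2 * suc r + r * suc r
      ≡⟨ solve 1 (λ r → con 2 :* (con 1 :+ r) :+ r :* (con 1 :+ r) := (con 1 :+ r) :* (con 2 :+ r)) refl r ⟩
    suc r * suc (suc r)               ∎
    where open ≡-Reasoning

  monomialCount-triangular-bound : ∀ r → monomialCount (suc r) (triangular r) * 10 ^ r ≤ (27 * r) ^ r
  monomialCount-triangular-bound r = *-cancelʳ-≤ (c * 10 ^ r) ((27 * r) ^ r) (r !) {{r !≢0}} (begin
    c * 10 ^ r * r !                 ≡⟨ solve 3 (λ a b f → a :* b :* f := a :* f :* b) refl c (10 ^ r) (r !) ⟩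
    c * r ! * 10 ^ r                 ≤⟨ *-monoˡ-≤ (10 ^ r) (monomialCount-bound r (triangular r)) ⟩
    (r + triangular r) ^ r * 10 ^ r  ≡⟨ trans (*-comm _ (10 ^ r)) (sym (^-distribʳ-* 10 (r + triangular r) r)) ⟩
    (10 * (r + triangular r)) ^ r    ≡⟨ cong (_^ r) 10[r+T]≡r*5[r+3] ⟩
    (r * (5 * (r + 3))) ^ r          ≡⟨ ^-distribʳ-* r (5 * (r + 3)) r ⟩
    r ^ r * (5 * (r + 3)) ^ r        ≤⟨ *-monoʳ-≤ (r ^ r) ([5[r+3]]^r≤27^r*r! r) ⟩
    r ^ r * (27 ^ r * r !)           ≡⟨ solve 3 (λ a b f → a :* (b :* f) := b :* a :* f) refl (r ^ r) (27 ^ r) (r !) ⟩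
    27 ^ r * r ^ r * r !             ≡⟨ cong (_* r !) (sym (^-distribʳ-* 27 r r)) ⟩
    (27 * r) ^ r * r !               ∎)
    where
    open ≤-Reasoning
    c = monomialCount (suc r) (triangular r)
    10[r+T]≡r*5[r+3] : 10 * (r + triangular r) ≡ r * (5 * (r + 3))
    10[r+T]≡r*5[r+3] = begin-equality
      10 * (r + triangular r)
        ≡⟨ solve 2 (λ r x → con 10 :* (r :+ x) := con 10 :* r :+ con 5 :* (con 2 :* x)) refl r (triangular r) ⟩
      10 * r + 5 * (2 * triangular r)
        ≡⟨ cong (λ z → 10 * r + 5 * z) (2*triangular r) ⟩
      10 * r + 5 * (r * suc r)
        ≡⟨ solve 1 (λ r → con 10 :* r :+ con 5 :* (r :* (con 1 :+ r)) := r :* (con 5 :* (r :+ con 3))) refl r ⟩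
      r * (5 * (r + 3)) ∎

  -- eNum N / eDen N ≥ 27/10: its sum contains 1 + 1 + 1/2 + 1/6 + 1/24 = 65/24 > 27/10 once N ≥ 4.
  e-lowerBound : ∀ N → 1 ≤ N → 27 * eDen N ≤ 10 * eNum N
  e-lowerBound 1 _ = ≤ᵇ⇒≤ _ _ tt
  e-lowerBound 2 _ = ≤ᵇ⇒≤ _ _ tt
  e-lowerBound 3 _ = ≤ᵇ⇒≤ _ _ tt
  e-lowerBound N@(suc (suc (suc (suc M)))) _ = *-cancelˡ-≤ 24 (begin
    24 * (27 * (N * N !))
      ≤⟨ ≤-trans (m≤m+n _ (2 * (N * N !))) (≤-reflexive
           (solve 2 (λ n f → con 24 :* (con 27 :* (n :* f)) :+ con 2 :* (n :* f) := con 10 :* (n :* (con 65 :* f)))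
              refl N (N !))) ⟩
    10 * (N * (65 * N !))
      ≤⟨ *-monoʳ-≤ 10 (*-monoʳ-≤ N firstTerms) ⟩
    10 * (N * (24 * s))
      ≡⟨ solve 2 (λ n s → con 10 :* (n :* (con 24 :* s)) := con 24 :* (con 10 :* (n :* s))) refl N s ⟩
    24 * (10 * (N * s))
      ≤⟨ *-monoʳ-≤ 24 (*-monoʳ-≤ 10 (m≤m+n (N * s) 1)) ⟩
    24 * (10 * (N * s + 1)) ∎)
    where
    open ≤-Reasoning
    f : ℕ → ℕ
    f k = (N ! / k !) {{k !≢0}}
    s = sum (map f (upTo (suc N)))
    rest = sum (map f (applyUpTo (5 +_) M))
    24*f≡ : ∀ k c → k ≤ N → c * k ! ≡ 24 → 24 * f k ≡ c * N !
    24*f≡ k c k≤N c*k!≡24 = begin-equality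
      24 * f k          ≡⟨ cong (_* f k) (sym c*k!≡24) ⟩
      c * k ! * f k     ≡⟨ solve 3 (λ c x y → c :* x :* y := c :* (y :* x)) refl c (k !) (f k) ⟩
      c * (f k * k !)   ≡⟨ cong (c *_) (m/n*n≡m {{k !≢0}} (m≤n⇒m!∣n! k≤N)) ⟩
      c * N !           ∎
    firstTerms : 65 * N ! ≤ 24 * s
    firstTerms = begin
      65 * N !
        ≡⟨ solve 1 (λ x → con 65 :* x := con 24 :* x :+ con 24 :* x :+ con 12 :* x :+ con 4 :* x :+ con 1 :* x)
             refl (N !) ⟩
      24 * N ! + 24 * N ! + 12 * N ! + 4 * N ! + 1 * N !
        ≡⟨ sym (cong₂ _+_ (cong₂ _+_ (cong₂ _+_ (cong₂ _+_
             (24*f≡ 0 24 z≤n refl) (24*f≡ 1 24 (s≤s z≤n) refl)) (24*f≡ 2 12 (s≤s (s≤s z≤n)) refl))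
             (24*f≡ 3 4 (s≤s (s≤s (s≤s z≤n))) refl)) (24*f≡ 4 1 (s≤s (s≤s (s≤s (s≤s z≤n)))) refl)) ⟩
      24 * f 0 + 24 * f 1 + 24 * f 2 + 24 * f 3 + 24 * f 4
        ≤⟨ m≤m+n _ (24 * rest) ⟩
      24 * f 0 + 24 * f 1 + 24 * f 2 + 24 * f 3 + 24 * f 4 + 24 * rest
        ≡⟨ solve 6 (λ a b c d e x → con 24 :* a :+ con 24 :* b :+ con 24 :* c :+ con 24 :* d :+ con 24 :* e :+ con 24 :* x
                                  := con 24 :* (a :+ (b :+ (c :+ (d :+ (e :+ x)))))) refl (f 0) (f 1) (f 2) (f 3) (f 4) rest ⟩
      24 * s ∎

  ≤monomialCount⇒LeREPowR : ∀ r m → m ≤ monomialCount (suc r) (triangular r) → LeREPowR m r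
  ≤monomialCount⇒LeREPowR r m m≤c N N≥1 =
    *-cancelʳ-≤ (m * eDen N ^ r) ((r * eNum N) ^ r) (10 ^ r) {{m^n≢0 10 r}} (begin
      m * eDen N ^ r * 10 ^ r
        ≡⟨ solve 3 (λ a b c → a :* b :* c := a :* c :* b) refl m (eDen N ^ r) (10 ^ r) ⟩
      m * 10 ^ r * eDen N ^ r
        ≤⟨ *-monoˡ-≤ (eDen N ^ r) (≤-trans (*-monoˡ-≤ (10 ^ r) m≤c) (monomialCount-triangular-bound r)) ⟩
      (27 * r) ^ r * eDen N ^ r
        ≡⟨ sym (^-distribʳ-* (27 * r) (eDen N) r) ⟩
      (27 * r * eDen N) ^ r
        ≤⟨ ^-monoˡ-≤ r 27r*eDen≤10r*eNum ⟩
      (10 * (r * eNum N)) ^ r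
        ≡⟨ trans (^-distribʳ-* 10 (r * eNum N) r) (*-comm (10 ^ r) _) ⟩
      (r * eNum N) ^ r * 10 ^ r ∎)
    where
    open ≤-Reasoning
    27r*eDen≤10r*eNum : 27 * r * eDen N ≤ 10 * (r * eNum N)
    27r*eDen≤10r*eNum = begin
      27 * r * eDen N      ≡⟨ solve 2 (λ r e → con 27 :* r :* e := r :* (con 27 :* e)) refl r (eDen N) ⟩
      r * (27 * eDen N)    ≤⟨ *-monoʳ-≤ r (e-lowerBound N N≥1) ⟩
      r * (10 * eNum N)    ≡⟨ solve 2 (λ r e → r :* (con 10 :* e) := con 10 :* (r :* e)) refl r (eNum N) ⟩
      10 * (r * eNum N)    ∎

open import Defs
open import Data.Nat using (ℕ; _≤_)
open import Data.Fin using (Fin; _<_)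
open import Data.List using (List; length)
open import Relation.Nullary using (¬_)
open import Function using (_∘_)
open import Relation.Binary.PropositionalEquality using (subst; sym)
open SkewSetPairs using (skewSetPairs)
open Codes using (suffixCodes; prefixCodes; length-suffixCodes; length-prefixCodes; compatible⇒disjoint; disjoint⇒compatible)
open Estimates using (≤monomialCount⇒LeREPowR)

corollary29 : {A : Set} (r m : ℕ) → 1 ≤ r →
    (σ ρ : Fin m → List A) →
    (∀ i → length (σ i) ≤ r) →
    (∀ i → length (ρ i) ≤ r) →
    (∀ i → Compatible r (σ i) (ρ i)) →
    (∀ i j → i < j → ¬ Compatible r (σ i) (ρ j)) →
    LeREPowR m r
corollary29 r m _ σ ρ |σ|≤r _ compatible incompatible =
  ≤monomialCount⇒LeREPowR r m
    (skewSetPairs (suffixCodes ∘ σ) (prefixCodes r ∘ ρ)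
      (λ i → subst (_≤ r) (sym (length-suffixCodes (σ i))) (|σ|≤r i))
      (λ i → length-prefixCodes r (ρ i))
      (λ i → compatible⇒disjoint (compatible i))
      (λ i j i<j → incompatible i j i<j ∘ disjoint⇒compatible))
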